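{- Let $m \geq \ell \geq 2$, let $n \geq 0$, and let $d$ be an integer. For every set of leaves $B \subseteq m^n$ with $\mathrm{LTD}_\ell(B) \leq d$, \[ |B| \leq \sum_{i=0}^{d} \binom{n}{i} (m-\ell+1)^i (\ell-1)^{n-i}. \]
   Context: For integers $m \geq 2$ and $k \geq 0$, $m^{\leq k}$ is the set of sequences of length at most $k$ with entries in $\{0,\dots,m-1\}$, and $m^k$ is the set of those of length exactly $k$. Elements of $m^n$ are called leaves. Write $a \prec b$ if $a$ is a proper initial segment of $b$. The meet $a \wedge b$ is the longest common initial segment of $a$ and $b$. Write $a \sim b$ if $|a| = |b|$. For $B \subseteq m^n$, $\check B$ is the set of all initial segments, including the sequences themselves, of elements of $B$. The leveled $\ell$-ary tree of height $d$ is $\widetilde T_{d,\ell} = (\ell^{\leq d}, \prec, \wedge, \sim)$. An embedding $f$ of $(A,\prec,\wedge,\sim)$ into $(A',\prec,\wedge,\sim)$ is an injective map satisfying, for all $a,a' \in A$: - $a \prec a'$ iff $f(a) \prec f(a')$; - $f(a \wedge a') = f(a) \wedge f(a')$; - $a \sim a'$ iff $f(a) \sim f(a')$. For nonempty $B \subseteq m^n$, the leveled $\ell$-ary tree dimension $\mathrm{LTD}_\ell(B)$ is the largest nonnegative integer $d$ such that $\widetilde T_{d,\ell}$ embeds in $(\check B, \prec, \wedge, \sim)$. Set $\mathrm{LTD}_\ell(\emptyset) = -1$. Binomial coefficients $\binom{n}{i}$ with $i > n$ are $0$. -}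

module Defs where

open import Data.Nat using (ℕ; zero; suc; _+_; _*_; _∸_; _^_; _≤_)
open import Data.Nat.Combinatorics using (_C_)
open import Data.Integer using (ℤ; +_; -[1+_]) renaming (_≤_ to _≤ℤ_)
open import Data.Fin using (Fin; _≟_)
open import Data.List using (List; []; _∷_; _++_; length)
open import Data.List.Membership.Propositional using (_∈_)
open import Data.List.Relation.Unary.All using (All)
open import Data.List.Relation.Unary.Unique.Propositional using (Unique)
open import Data.Product using (Σ; _×_; _,_)
open import Relation.Binary.PropositionalEquality using (_≡_; _≢_)
open import Relation.Nullary using (yes; no)
open import Function.Bundles using (_⇔_)

_≺_ : ∀ {m} → List (Fin m) → List (Fin m) → Set
a ≺ b = Σ (List _) λ c → (c ≢ []) × (a ++ c ≡ b)

_⊑_ : ∀ {m} → List (Fin m) → List (Fin m) → Set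
a ⊑ b = Σ (List _) λ c → a ++ c ≡ b

meet : ∀ {m} → List (Fin m) → List (Fin m) → List (Fin m)
meet [] _ = []
meet (_ ∷ _) [] = []
meet (x ∷ xs) (y ∷ ys) with x ≟ y
... | yes _ = x ∷ meet xs ys
... | no _ = []

_∼_ : ∀ {m} → List (Fin m) → List (Fin m) → Set
a ∼ b = length a ≡ length b

IsLeafSet : (m n : ℕ) → List (List (Fin m)) → Set
IsLeafSet m n B = All (λ b → length b ≡ n) B × Unique B

InCheck : ∀ {m} → List (List (Fin m)) → List (Fin m) → Set
InCheck B a = Σ _ λ b → (b ∈ B) × (a ⊑ b)

-- an embedding of the leveled ℓ-ary tree of height e, (ℓ^{≤e}, ≺, ∧, ∼),
-- into (Bˇ, ≺, ∧, ∼); the map is given on all lists but only its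
-- restriction to ℓ^{≤e} (lists of length ≤ e) matters.
IsTreeEmbedding : (e ℓ : ℕ) {m : ℕ} → List (List (Fin m)) →
                  (List (Fin ℓ) → List (Fin m)) → Set
IsTreeEmbedding e ℓ B f =
  (∀ a → length a ≤ e → InCheck B (f a)) ×
  (∀ a a' → length a ≤ e → length a' ≤ e → f a ≡ f a' → a ≡ a') ×
  (∀ a a' → length a ≤ e → length a' ≤ e → (a ≺ a') ⇔ (f a ≺ f a')) ×
  (∀ a a' → length a ≤ e → length a' ≤ e → f (meet a a') ≡ meet (f a) (f a')) ×
  (∀ a a' → length a ≤ e → length a' ≤ e → (a ∼ a') ⇔ (f a ∼ f a'))

TreeEmbeds : (e ℓ : ℕ) {m : ℕ} → List (List (Fin m)) → Set
TreeEmbeds e ℓ {m} B = Σ (List (Fin ℓ) → List (Fin m)) (IsTreeEmbedding e ℓ B)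

-- LTD_ℓ(B) ≤ d.  LTD_ℓ(∅) = -1; for nonempty B, LTD_ℓ(B) is the largest e
-- such that the tree of height e embeds, so LTD_ℓ(B) ≤ d iff every such
-- e satisfies e ≤ d.
LTD≤ : (ℓ : ℕ) {m : ℕ} → List (List (Fin m)) → ℤ → Set
LTD≤ ℓ B d =
  (B ≡ [] → -[1+ 0 ] ≤ℤ d) ×
  (B ≢ [] → ∀ e → TreeEmbeds e ℓ B → + e ≤ℤ d)

sumUpTo : ℕ → (ℕ → ℕ) → ℕ
sumUpTo zero f = f 0
sumUpTo (suc k) f = sumUpTo k f + f (suc k)

sumTo : ℤ → (ℕ → ℕ) → ℕ
sumTo (+ k) f = sumUpTo k f
sumTo -[1+ _ ] f = 0

bound : (m ℓ n : ℕ) → ℤ → ℕ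
bound m ℓ n d = sumTo d (λ i → (n C i) * ((m ∸ ℓ + 1) ^ i) * ((ℓ ∸ 1) ^ (n ∸ i)))

{-# OPTIONS --safe #-}

-- A pattern s ∈ {F,T}^n is shattered by B ⊆ m^n when, level by level from the root, at
-- least one child (at an F) resp. at least ℓ children (at a T) of the current node shatter
-- the rest of s. Splitting B along its first coordinate, the number c ≤ m of children
-- shattering a tail satisfies c ≤ [c ≥ 1](ℓ-1) + [c ≥ ℓ](m-ℓ+1), so by induction on n
-- |B| ≤ Σ (ℓ-1)^#F (m-ℓ+1)^#T over the shattered patterns. A shattered pattern with t
-- letters T carries a leveled embedding of the ℓ-ary tree of height t (branch at T levels,
-- follow the single child at F levels), hence t ≤ LTD_ℓ(B) ≤ d; and the weights of the
-- patterns with t letters T add up to C(n,t) (m-ℓ+1)^t (ℓ-1)^(n-t).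

module Submission where

open import Defs
open import Data.Nat using (ℕ; _≤_)
open import Data.Integer using (ℤ)
open import Data.Fin using (Fin)
open import Data.List using (List; length)

open import Data.Bool using (Bool; true; false; T)
open import Data.Nat using (zero; suc; _+_; _*_; _∸_; _^_; z≤n; s≤s; _<_; _≤ᵇ_; _≡ᵇ_; _<?_; _≤?_)
open import Data.Nat.Properties hiding (_≟_)
open import Data.Nat.Combinatorics using (_C_; k>n⇒nCk≡0; nCk+nC[k+1]≡[n+1]C[k+1])
import Data.Integer as ℤ
import Data.Integer.Properties as ℤ
open import Data.Fin using (zero; suc; _≟_; fromℕ<)
open import Data.List using ([]; _∷_)
open import Data.List.Properties using (∷-injectiveˡ; ∷-injectiveʳ)
open import Data.Unit using (tt)
open import Relation.Binary.PropositionalEquality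
open import Relation.Nullary using (yes; no; does; ¬_; contradiction)
open import Function using (_∘_)
open import Function.Definitions using (Injective)
open import Function.Bundles using (_⇔_; mk⇔; Equivalence)
open import Function.Construct.Composition using (_⇔-∘_)
open import Data.Fin.Properties using () renaming (suc-injective to fsuc-injective)
open import Data.Product using (Σ; _×_; _,_; proj₂)
open import Data.List.Membership.Propositional using (_∈_)
open import Data.List.Relation.Unary.Any using (here; there)
open import Data.List.Relation.Unary.All as All using (All; []; _∷_)
open import Data.List.Relation.Unary.Unique.Propositional using (Unique)
open import Data.List.Relation.Unary.AllPairs using ([]; _∷_)
open import Algebra.Properties.Semiring.Sum +-*-semiring
  using (sum-syntax; sum-cong-≗; sum-replicate-zero; ∑-distrib-+; *-distribʳ-sum)
open import Algebra.Properties.CommutativeSemigroup +-commutativeSemigroup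
  using () renaming (interchange to +-interchange)
open import Algebra.Properties.CommutativeSemigroup *-commutativeSemigroup
  using () renaming (x∙yz≈y∙xz to *-left-comm)
open import Data.Nat.Solver using (module +-*-Solver)

¬⇔¬ : ∀ {a b} {A : Set a} {B : Set b} → ¬ A → ¬ B → A ⇔ B
¬⇔¬ ¬a ¬b = mk⇔ (λ a → contradiction a ¬a) (λ b → contradiction b ¬b)

𝟙 : Bool → ℕ
𝟙 true = 1
𝟙 false = 0

𝟙-mono : ∀ {b c : Bool} → (T b → T c) → 𝟙 b ≤ 𝟙 c
𝟙-mono {false} _ = z≤n
𝟙-mono {true} {true} _ = ≤-refl
𝟙-mono {true} {false} f with f tt
... | ()

T⇒𝟙≡1 : ∀ {b} → T b → 𝟙 b ≡ 1
T⇒𝟙≡1 {true} _ = refl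

¬T⇒𝟙≡0 : ∀ {b} → ¬ T b → 𝟙 b ≡ 0
¬T⇒𝟙≡0 {false} _ = refl
¬T⇒𝟙≡0 {true} ¬t = contradiction tt ¬t

𝟙-≤ᵇ-suc : ∀ t k → 𝟙 (t ≤ᵇ k) + 𝟙 (t ≡ᵇ suc k) ≡ 𝟙 (t ≤ᵇ suc k)
𝟙-≤ᵇ-suc zero k = refl
𝟙-≤ᵇ-suc (suc zero) zero = refl
𝟙-≤ᵇ-suc (suc (suc t)) zero = refl
𝟙-≤ᵇ-suc (suc zero) (suc k) = refl
𝟙-≤ᵇ-suc (suc (suc t)) (suc k) = 𝟙-≤ᵇ-suc (suc t) k

∑-mono-≤ : ∀ {k} {f g : Fin k → ℕ} → (∀ j → f j ≤ g j) → ∑[ j < k ] f j ≤ ∑[ j < k ] g j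
∑-mono-≤ {zero} _ = z≤n
∑-mono-≤ {suc k} f≤g = +-mono-≤ (f≤g zero) (∑-mono-≤ (λ j → f≤g (suc j)))

∑-𝟙≤ : ∀ {k} (p : Fin k → Bool) → ∑[ j < k ] 𝟙 (p j) ≤ k
∑-𝟙≤ {zero} p = z≤n
∑-𝟙≤ {suc k} p with p zero
... | true = s≤s (∑-𝟙≤ (λ j → p (suc j)))
... | false = m≤n⇒m≤1+n (∑-𝟙≤ (λ j → p (suc j)))

∑-𝟙-≟ : ∀ {k} (x : Fin k) → ∑[ j < k ] 𝟙 (does (x ≟ j)) ≡ 1
∑-𝟙-≟ {suc k} zero = cong suc (sum-replicate-zero k)
∑-𝟙-≟ {suc k} (suc x) = ∑-𝟙-≟ x

distinct-choice : ∀ {k} (p : Fin k → Bool) {r} → r ≤ ∑[ j < k ] 𝟙 (p j) →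
  Σ (Fin r → Fin k) λ g → Injective _≡_ _≡_ g × (∀ i → T (p (g i)))
distinct-choice {zero} p {zero} _ = (λ ()) , (λ {}) , (λ ())
distinct-choice {suc k} p {r} r≤ with p zero in p0
distinct-choice {suc k} p {zero} _ | true = (λ ()) , (λ {}) , (λ ())
distinct-choice {suc k} p {suc r} (s≤s r≤) | true
  with g , g-inj , pg ← distinct-choice (λ j → p (suc j)) r≤ = g′ , g′-inj , pg′
  where
  g′ : Fin (suc r) → Fin (suc k)
  g′ zero = zero
  g′ (suc i) = suc (g i)
  g′-inj : Injective _≡_ _≡_ g′
  g′-inj {zero} {zero} _ = refl
  g′-inj {suc i} {suc i′} e = cong suc (g-inj (fsuc-injective e))
  pg′ : ∀ i → T (p (g′ i))
  pg′ zero rewrite p0 = tt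
  pg′ (suc i) = pg i
distinct-choice {suc k} p {r} r≤ | false
  with g , g-inj , pg ← distinct-choice (λ j → p (suc j)) r≤ =
  (λ i → suc (g i)) , (λ e → g-inj (fsuc-injective e)) , pg

-- Σ over all patterns s ∈ {F,T}^n, with true for T: the levels at which the embedded tree branches.
∑ᴾ : ℕ → (List Bool → ℕ) → ℕ
∑ᴾ zero F = F []
∑ᴾ (suc n) F = ∑ᴾ n (λ s → F (false ∷ s)) + ∑ᴾ n (λ s → F (true ∷ s))

∑ᴾ-cong : ∀ n {F G : List Bool → ℕ} → (∀ s → F s ≡ G s) → ∑ᴾ n F ≡ ∑ᴾ n G
∑ᴾ-cong zero F≗G = F≗G []
∑ᴾ-cong (suc n) F≗G = cong₂ _+_ (∑ᴾ-cong n (λ s → F≗G _)) (∑ᴾ-cong n (λ s → F≗G _))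

∑ᴾ-mono-≤ : ∀ n {F G : List Bool → ℕ} → (∀ s → F s ≤ G s) → ∑ᴾ n F ≤ ∑ᴾ n G
∑ᴾ-mono-≤ zero F≤G = F≤G []
∑ᴾ-mono-≤ (suc n) F≤G = +-mono-≤ (∑ᴾ-mono-≤ n (λ s → F≤G _)) (∑ᴾ-mono-≤ n (λ s → F≤G _))

∑ᴾ-zero : ∀ n → ∑ᴾ n (λ _ → 0) ≡ 0
∑ᴾ-zero zero = refl
∑ᴾ-zero (suc n) = cong₂ _+_ (∑ᴾ-zero n) (∑ᴾ-zero n)

∑ᴾ-distrib-+ : ∀ n (F G : List Bool → ℕ) → ∑ᴾ n (λ s → F s + G s) ≡ ∑ᴾ n F + ∑ᴾ n G
∑ᴾ-distrib-+ zero F G = refl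
∑ᴾ-distrib-+ (suc n) F G =
  trans (cong₂ _+_ (∑ᴾ-distrib-+ n F₀ G₀) (∑ᴾ-distrib-+ n F₁ G₁))
        (+-interchange (∑ᴾ n F₀) (∑ᴾ n G₀) (∑ᴾ n F₁) (∑ᴾ n G₁))
  where
  F₀ F₁ G₀ G₁ : List Bool → ℕ
  F₀ s = F (false ∷ s)
  F₁ s = F (true ∷ s)
  G₀ s = G (false ∷ s)
  G₁ s = G (true ∷ s)

∑ᴾ-distribˡ-* : ∀ n c (F : List Bool → ℕ) → ∑ᴾ n (λ s → c * F s) ≡ c * ∑ᴾ n F
∑ᴾ-distribˡ-* zero c F = refl
∑ᴾ-distribˡ-* (suc n) c F =
  trans (cong₂ _+_ (∑ᴾ-distribˡ-* n c _) (∑ᴾ-distribˡ-* n c _)) (sym (*-distribˡ-+ c _ _))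

∑ᴾ-*-left-comm : ∀ n c (F G : List Bool → ℕ) →
  ∑ᴾ n (λ s → F s * (c * G s)) ≡ c * ∑ᴾ n (λ s → F s * G s)
∑ᴾ-*-left-comm n c F G =
  trans (∑ᴾ-cong n (λ s → *-left-comm (F s) c (G s))) (∑ᴾ-distribˡ-* n c _)

∑-∑ᴾ-comm : ∀ k n (F : Fin k → List Bool → ℕ) →
  ∑[ j < k ] ∑ᴾ n (F j) ≡ ∑ᴾ n (λ s → ∑[ j < k ] F j s)
∑-∑ᴾ-comm zero n F = sym (∑ᴾ-zero n)
∑-∑ᴾ-comm (suc k) n F =
  trans (cong (∑ᴾ n (F zero) +_) (∑-∑ᴾ-comm k n (λ j → F (suc j)))) (sym (∑ᴾ-distrib-+ n _ _))

sumUpTo-∑ᴾ-comm : ∀ k n (F : ℕ → List Bool → ℕ) →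
  sumUpTo k (λ i → ∑ᴾ n (F i)) ≡ ∑ᴾ n (λ s → sumUpTo k (λ i → F i s))
sumUpTo-∑ᴾ-comm zero n F = refl
sumUpTo-∑ᴾ-comm (suc k) n F =
  trans (cong (_+ ∑ᴾ n (F (suc k))) (sumUpTo-∑ᴾ-comm k n F)) (sym (∑ᴾ-distrib-+ n _ _))

sumUpTo-cong : ∀ k {f g : ℕ → ℕ} → (∀ i → f i ≡ g i) → sumUpTo k f ≡ sumUpTo k g
sumUpTo-cong zero f≗g = f≗g 0
sumUpTo-cong (suc k) f≗g = cong₂ _+_ (sumUpTo-cong k f≗g) (f≗g (suc k))

sumUpTo-𝟙-≡ᵇ : ∀ k t x → sumUpTo k (λ i → 𝟙 (t ≡ᵇ i) * x) ≡ 𝟙 (t ≤ᵇ k) * x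
sumUpTo-𝟙-≡ᵇ zero zero x = refl
sumUpTo-𝟙-≡ᵇ zero (suc t) x = refl
sumUpTo-𝟙-≡ᵇ (suc k) t x = begin
  sumUpTo k (λ i → 𝟙 (t ≡ᵇ i) * x) + 𝟙 (t ≡ᵇ suc k) * x
    ≡⟨ cong (_+ 𝟙 (t ≡ᵇ suc k) * x) (sumUpTo-𝟙-≡ᵇ k t x) ⟩
  𝟙 (t ≤ᵇ k) * x + 𝟙 (t ≡ᵇ suc k) * x
    ≡⟨ *-distribʳ-+ x (𝟙 (t ≤ᵇ k)) (𝟙 (t ≡ᵇ suc k)) ⟨
  (𝟙 (t ≤ᵇ k) + 𝟙 (t ≡ᵇ suc k)) * x
    ≡⟨ cong (_* x) (𝟙-≤ᵇ-suc t k) ⟩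
  𝟙 (t ≤ᵇ suc k) * x ∎
  where open ≡-Reasoning

∸-suc : ∀ {i n} → i < n → n ∸ i ≡ suc (n ∸ suc i)
∸-suc {zero} {suc n} _ = refl
∸-suc {suc i} {suc n} (s≤s i<n) = ∸-suc i<n

*-C-pow-shift : ∀ b n i → b * ((n C suc i) * b ^ (n ∸ suc i)) ≡ (n C suc i) * b ^ (n ∸ i)
*-C-pow-shift b n i with i <? n
... | yes i<n rewrite ∸-suc i<n = *-left-comm b (n C suc i) (b ^ (n ∸ suc i))
... | no i≮n rewrite k>n⇒nCk≡0 (s≤s (≮⇒≥ i≮n)) = *-zeroʳ b

binomial-term-pascal : ∀ a b n i →
  b * ((n C suc i) * a ^ suc i * b ^ (n ∸ suc i)) + a * ((n C i) * a ^ i * b ^ (n ∸ i))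
    ≡ (suc n C suc i) * a ^ suc i * b ^ (n ∸ i)
binomial-term-pascal a b n i = begin
  b * ((n C suc i) * a ^ suc i * b ^ (n ∸ suc i)) + a * ((n C i) * a ^ i * b ^ (n ∸ i))
    ≡⟨ solve 7 (λ b c a aⁱ bʲ c′ bᵏ → b :* (c :* (a :* aⁱ) :* bʲ) :+ a :* (c′ :* aⁱ :* bᵏ)
               := b :* (c :* bʲ) :* (a :* aⁱ) :+ c′ :* (a :* aⁱ) :* bᵏ)
             refl b (n C suc i) a (a ^ i) (b ^ (n ∸ suc i)) (n C i) (b ^ (n ∸ i)) ⟩
  b * ((n C suc i) * b ^ (n ∸ suc i)) * a ^ suc i + (n C i) * a ^ suc i * b ^ (n ∸ i)
    ≡⟨ cong (λ x → x * a ^ suc i + (n C i) * a ^ suc i * b ^ (n ∸ i)) (*-C-pow-shift b n i) ⟩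
  (n C suc i) * b ^ (n ∸ i) * a ^ suc i + (n C i) * a ^ suc i * b ^ (n ∸ i)
    ≡⟨ solve 4 (λ c aᵢ bᵏ c′ → c :* bᵏ :* aᵢ :+ c′ :* aᵢ :* bᵏ := (c′ :+ c) :* aᵢ :* bᵏ)
             refl (n C suc i) (a ^ suc i) (b ^ (n ∸ i)) (n C i) ⟩
  ((n C i) + (n C suc i)) * a ^ suc i * b ^ (n ∸ i)
    ≡⟨ cong (λ x → x * a ^ suc i * b ^ (n ∸ i)) (nCk+nC[k+1]≡[n+1]C[k+1] n i) ⟩
  (suc n C suc i) * a ^ suc i * b ^ (n ∸ i) ∎
  where
  open ≡-Reasoning
  open +-*-Solver

m≤ℓ∸1+[m∸ℓ+1] : ∀ ℓ m → m ≤ ℓ ∸ 1 + (m ∸ ℓ + 1)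
m≤ℓ∸1+[m∸ℓ+1] zero m = m≤m+n m 1
m≤ℓ∸1+[m∸ℓ+1] (suc ℓ) m = begin
  m                   ≤⟨ m≤n+m∸n m (suc ℓ) ⟩
  suc ℓ + (m ∸ suc ℓ) ≡⟨ +-suc ℓ (m ∸ suc ℓ) ⟨
  ℓ + suc (m ∸ suc ℓ) ≡⟨ cong (ℓ +_) (+-comm 1 (m ∸ suc ℓ)) ⟩
  ℓ + (m ∸ suc ℓ + 1) ∎
  where open ≤-Reasoning

height : List Bool → ℕ
height [] = 0
height (false ∷ s) = height s
height (true ∷ s) = suc (height s)

module PatternWeights (ω : Bool → ℕ) where

  weight : List Bool → ℕ
  weight [] = 1
  weight (b ∷ s) = ω b * weight s

  ∑ᴾ-height≡ : ∀ n i → ∑ᴾ n (λ s → 𝟙 (height s ≡ᵇ i) * weight s)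
                      ≡ (n C i) * ω true ^ i * ω false ^ (n ∸ i)
  ∑ᴾ-height≡ zero zero = refl
  ∑ᴾ-height≡ zero (suc i) = refl
  ∑ᴾ-height≡ (suc n) zero = begin
    ∑ᴾ n (λ s → 𝟙 (height s ≡ᵇ 0) * (b * weight s)) + ∑ᴾ n (λ _ → 0)
      ≡⟨ cong₂ _+_ (∑ᴾ-*-left-comm n b (λ s → 𝟙 (height s ≡ᵇ 0)) weight) (∑ᴾ-zero n) ⟩
    b * ∑ᴾ n (λ s → 𝟙 (height s ≡ᵇ 0) * weight s) + 0
      ≡⟨ cong (λ x → b * x + 0) (∑ᴾ-height≡ n zero) ⟩
    b * (1 * 1 * b ^ n) + 0
      ≡⟨ solve 2 (λ b x → b :* (con 1 :* con 1 :* x) :+ con 0 := con 1 :* con 1 :* (b :* x))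
               refl b (b ^ n) ⟩
    1 * 1 * (b * b ^ n) ∎
    where
    open ≡-Reasoning
    open +-*-Solver
    b = ω false
  ∑ᴾ-height≡ (suc n) (suc i) = begin
    ∑ᴾ n (λ s → 𝟙 (height s ≡ᵇ suc i) * (b * weight s))
      + ∑ᴾ n (λ s → 𝟙 (height s ≡ᵇ i) * (a * weight s))
      ≡⟨ cong₂ _+_ (∑ᴾ-*-left-comm n b (λ s → 𝟙 (height s ≡ᵇ suc i)) weight)
                   (∑ᴾ-*-left-comm n a (λ s → 𝟙 (height s ≡ᵇ i)) weight) ⟩
    b * ∑ᴾ n (λ s → 𝟙 (height s ≡ᵇ suc i) * weight s)
      + a * ∑ᴾ n (λ s → 𝟙 (height s ≡ᵇ i) * weight s)
      ≡⟨ cong₂ (λ x y → b * x + a * y) (∑ᴾ-height≡ n (suc i)) (∑ᴾ-height≡ n i) ⟩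
    b * ((n C suc i) * a ^ suc i * b ^ (n ∸ suc i)) + a * ((n C i) * a ^ i * b ^ (n ∸ i))
      ≡⟨ binomial-term-pascal a b n i ⟩
    (suc n C suc i) * a ^ suc i * b ^ (n ∸ i) ∎
    where
    open ≡-Reasoning
    a = ω true
    b = ω false

  sumUpTo-binomial≡∑ᴾ-height≤ : ∀ n k →
    sumUpTo k (λ i → (n C i) * ω true ^ i * ω false ^ (n ∸ i))
      ≡ ∑ᴾ n (λ s → 𝟙 (height s ≤ᵇ k) * weight s)
  sumUpTo-binomial≡∑ᴾ-height≤ n k = begin
    sumUpTo k (λ i → (n C i) * ω true ^ i * ω false ^ (n ∸ i))
      ≡⟨ sumUpTo-cong k (λ i → sym (∑ᴾ-height≡ n i)) ⟩
    sumUpTo k (λ i → ∑ᴾ n (λ s → 𝟙 (height s ≡ᵇ i) * weight s))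
      ≡⟨ sumUpTo-∑ᴾ-comm k n _ ⟩
    ∑ᴾ n (λ s → sumUpTo k (λ i → 𝟙 (height s ≡ᵇ i) * weight s))
      ≡⟨ ∑ᴾ-cong n (λ s → sumUpTo-𝟙-≡ᵇ k (height s) (weight s)) ⟩
    ∑ᴾ n (λ s → 𝟙 (height s ≤ᵇ k) * weight s) ∎
    where open ≡-Reasoning

  sumTo-binomial≡∑ᴾ-height≤ : ∀ n d →
    sumTo d (λ i → (n C i) * ω true ^ i * ω false ^ (n ∸ i))
      ≡ ∑ᴾ n (λ s → 𝟙 (ℤ.+ height s ℤ.≤ᵇ d) * weight s)
  sumTo-binomial≡∑ᴾ-height≤ n (ℤ.+ k) = sumUpTo-binomial≡∑ᴾ-height≤ n k
  sumTo-binomial≡∑ᴾ-height≤ n ℤ.-[1+ _ ] = sym (∑ᴾ-zero n)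

module _ {m : ℕ} where

  ∷-≺-∷ : ∀ {x y : Fin m} {a b} → (x ∷ a) ≺ (y ∷ b) → x ≡ y × a ≺ b
  ∷-≺-∷ (c , c≢[] , eq) = ∷-injectiveˡ eq , (c , c≢[] , ∷-injectiveʳ eq)

  ≺-∷ : ∀ (x : Fin m) {a b} → a ≺ b → (x ∷ a) ≺ (x ∷ b)
  ≺-∷ x (c , c≢[] , eq) = c , c≢[] , cong (x ∷_) eq

  []≺∷ : ∀ {x : Fin m} {b} → [] ≺ (x ∷ b)
  []≺∷ {x} {b} = (x ∷ b) , (λ ()) , refl

  ≺-irrefl-[] : ¬ ([] {A = Fin m} ≺ [])
  ≺-irrefl-[] (c , c≢[] , eq) = c≢[] eq

  ∷-⊀-[] : ∀ {x : Fin m} {a} → ¬ ((x ∷ a) ≺ [])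
  ∷-⊀-[] (_ , _ , ())

  ≺⇔∷≺∷ : ∀ (x : Fin m) {a b} → a ≺ b ⇔ (x ∷ a) ≺ (x ∷ b)
  ≺⇔∷≺∷ x = mk⇔ (≺-∷ x) (proj₂ ∘ ∷-≺-∷)

  meet-∷-≡ : ∀ (x : Fin m) a b → meet (x ∷ a) (x ∷ b) ≡ x ∷ meet a b
  meet-∷-≡ x a b with x ≟ x
  ... | yes _ = refl
  ... | no x≢x = contradiction refl x≢x

  meet-∷-≢ : ∀ {x y : Fin m} a b → x ≢ y → meet (x ∷ a) (y ∷ b) ≡ []
  meet-∷-≢ {x} {y} a b x≢y with x ≟ y
  ... | yes x≡y = contradiction x≡y x≢y
  ... | no _ = refl

  ∈⇒≢[] : ∀ {b : List (Fin m)} {B} → b ∈ B → B ≢ []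
  ∈⇒≢[] (here _) ()
  ∈⇒≢[] (there _) ()

  length≡suc⇒≢[] : ∀ {b : List (Fin m)} {n} → length b ≡ suc n → b ≢ []
  length≡suc⇒≢[] () refl

  child : Fin m → List (List (Fin m)) → List (List (Fin m))
  child j [] = []
  child j ([] ∷ B) = child j B
  child j ((x ∷ b) ∷ B) with x ≟ j
  ... | yes _ = b ∷ child j B
  ... | no _ = child j B

  ∈-child⁻ : ∀ j {b} B → b ∈ child j B → (j ∷ b) ∈ B
  ∈-child⁻ j ([] ∷ B) b∈ = there (∈-child⁻ j B b∈)
  ∈-child⁻ j ((x ∷ c) ∷ B) b∈ with x ≟ j
  ∈-child⁻ j ((x ∷ c) ∷ B) (here refl) | yes refl = here refl
  ∈-child⁻ j ((x ∷ c) ∷ B) (there b∈) | yes refl = there (∈-child⁻ j B b∈)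
  ... | no _ = there (∈-child⁻ j B b∈)

  All-child : ∀ {P Q : List (Fin m) → Set} j → (∀ {c} → P (j ∷ c) → Q c) →
    ∀ {B} → All P B → All Q (child j B)
  All-child j P⇒Q {[]} [] = []
  All-child j P⇒Q {[] ∷ B} (_ ∷ pB) = All-child j P⇒Q pB
  All-child j P⇒Q {(x ∷ c) ∷ B} (px ∷ pB) with x ≟ j
  ... | yes refl = P⇒Q px ∷ All-child j P⇒Q pB
  ... | no _ = All-child j P⇒Q pB

  Unique-child : ∀ j {B} → Unique B → Unique (child j B)
  Unique-child j {[]} [] = []
  Unique-child j {[] ∷ B} (_ ∷ u) = Unique-child j u
  Unique-child j {(x ∷ c) ∷ B} (c∉ ∷ u) with x ≟ j
  ... | yes refl = All-child x (λ ne eq → ne (cong (x ∷_) eq)) c∉ ∷ Unique-child j u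
  ... | no _ = Unique-child j u

  length-child-∷ : ∀ j x b B →
    length (child j ((x ∷ b) ∷ B)) ≡ 𝟙 (does (x ≟ j)) + length (child j B)
  length-child-∷ j x b B with x ≟ j
  ... | yes _ = refl
  ... | no _ = refl

  length≡∑-length-child : ∀ {B} → All (_≢ []) B → length B ≡ ∑[ j < m ] length (child j B)
  length≡∑-length-child {[]} [] = sym (sum-replicate-zero m)
  length≡∑-length-child {[] ∷ B} ([]≢[] ∷ _) = contradiction refl []≢[]
  length≡∑-length-child {(x ∷ b) ∷ B} (_ ∷ B≢[]) = sym (begin
    ∑[ j < m ] length (child j ((x ∷ b) ∷ B))
      ≡⟨ sum-cong-≗ (λ j → length-child-∷ j x b B) ⟩
    ∑[ j < m ] (𝟙 (does (x ≟ j)) + length (child j B))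
      ≡⟨ ∑-distrib-+ (λ j → 𝟙 (does (x ≟ j))) (λ j → length (child j B)) ⟩
    ∑[ j < m ] 𝟙 (does (x ≟ j)) + ∑[ j < m ] length (child j B)
      ≡⟨ cong₂ _+_ (∑-𝟙-≟ x) (sym (length≡∑-length-child B≢[])) ⟩
    suc (length B) ∎)
    where open ≡-Reasoning

  InCheck-child : ∀ j B {a} → InCheck (child j B) a → InCheck B (j ∷ a)
  InCheck-child j B (b , b∈ , (c , eq)) = (j ∷ b) , ∈-child⁻ j B b∈ , (c , cong (j ∷_) eq)

  InCheck-[] : ∀ B {a : List (Fin m)} → InCheck B a → InCheck B []
  InCheck-[] B (b , b∈ , _) = b , b∈ , (b , refl)

levelDepth : List Bool → ℕ → ℕ
levelDepth [] k = 0
levelDepth (false ∷ s) k = suc (levelDepth s k)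
levelDepth (true ∷ s) zero = 0
levelDepth (true ∷ s) (suc k) = suc (levelDepth s k)

levelDepth-injective : ∀ s {k k′} → k ≤ height s → k′ ≤ height s →
  levelDepth s k ≡ levelDepth s k′ → k ≡ k′
levelDepth-injective [] z≤n z≤n _ = refl
levelDepth-injective (false ∷ s) k≤ k′≤ eq = levelDepth-injective s k≤ k′≤ (suc-injective eq)
levelDepth-injective (true ∷ s) {zero} {zero} _ _ _ = refl
levelDepth-injective (true ∷ s) {suc k} {suc k′} (s≤s k≤) (s≤s k′≤) eq =
  cong suc (levelDepth-injective s k≤ k′≤ (suc-injective eq))

module Shattering (m ℓ : ℕ) where

  threshold : Bool → ℕ
  threshold false = 1
  threshold true = ℓ

  ω : Bool → ℕ
  ω false = ℓ ∸ 1
  ω true = m ∸ ℓ + 1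

  open PatternWeights ω public

  shatters : List Bool → List (List (Fin m)) → Bool
  shatters [] [] = false
  shatters [] (_ ∷ _) = true
  shatters (b ∷ s) B = threshold b ≤ᵇ ∑[ j < m ] 𝟙 (shatters s (child j B))

  branching : List Bool → List (List (Fin m)) → ℕ
  branching s B = ∑[ j < m ] 𝟙 (shatters s (child j B))

  shatterWeight : ℕ → List (List (Fin m)) → ℕ
  shatterWeight n B = ∑ᴾ n (λ s → 𝟙 (shatters s B) * weight s)

  ≤-thresholds : ∀ c → c ≤ m →
    c ≤ 𝟙 (threshold false ≤ᵇ c) * ω false + 𝟙 (threshold true ≤ᵇ c) * ω true
  ≤-thresholds zero _ = z≤n
  ≤-thresholds (suc c) c<m with ℓ ≤? suc c
  ... | yes ℓ≤c rewrite T⇒𝟙≡1 (≤⇒≤ᵇ ℓ≤c) = ≤-trans c<m (≤-trans (m≤ℓ∸1+[m∸ℓ+1] ℓ m)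
      (≤-reflexive (sym (cong₂ _+_ (*-identityˡ (ℓ ∸ 1)) (*-identityˡ (m ∸ ℓ + 1))))))
  ... | no ℓ≰c rewrite ¬T⇒𝟙≡0 (ℓ≰c ∘ ≤ᵇ⇒≤ ℓ (suc c)) = ≤-trans (∸-monoˡ-≤ 1 (≰⇒> ℓ≰c))
      (≤-reflexive (sym (trans (+-identityʳ (1 * (ℓ ∸ 1))) (*-identityˡ (ℓ ∸ 1)))))

  *-≤-thresholds : ∀ c x → c ≤ m →
    c * x ≤ 𝟙 (threshold false ≤ᵇ c) * (ω false * x) + 𝟙 (threshold true ≤ᵇ c) * (ω true * x)
  *-≤-thresholds c x c≤m = begin
    c * x
      ≤⟨ *-monoˡ-≤ x (≤-thresholds c c≤m) ⟩
    (i₀ * ω false + i₁ * ω true) * x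
      ≡⟨ *-distribʳ-+ x (i₀ * ω false) (i₁ * ω true) ⟩
    i₀ * ω false * x + i₁ * ω true * x
      ≡⟨ cong₂ _+_ (*-assoc i₀ (ω false) x) (*-assoc i₁ (ω true) x) ⟩
    i₀ * (ω false * x) + i₁ * (ω true * x) ∎
    where
    open ≤-Reasoning
    i₀ = 𝟙 (threshold false ≤ᵇ c)
    i₁ = 𝟙 (threshold true ≤ᵇ c)

  length≤shatterWeight : ∀ n {B} → All (λ b → length b ≡ n) B → Unique B →
    length B ≤ shatterWeight n B
  length≤shatterWeight zero {[]} _ _ = z≤n
  length≤shatterWeight zero {_ ∷ []} _ _ = s≤s z≤n
  length≤shatterWeight zero {[] ∷ [] ∷ _} _ (([]≢[] ∷ _) ∷ _) = contradiction refl []≢[]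
  length≤shatterWeight zero {[] ∷ (_ ∷ _) ∷ _} (_ ∷ () ∷ _) _
  length≤shatterWeight zero {(_ ∷ _) ∷ _ ∷ _} (() ∷ _) _
  length≤shatterWeight (suc n) {B} lengths unique = begin
    length B
      ≡⟨ length≡∑-length-child (All.map length≡suc⇒≢[] lengths) ⟩
    ∑[ j < m ] length (child j B)
      ≤⟨ ∑-mono-≤ (λ j → length≤shatterWeight n (All-child j suc-injective lengths)
                                                 (Unique-child j unique)) ⟩
    ∑[ j < m ] shatterWeight n (child j B)
      ≡⟨ ∑-∑ᴾ-comm m n (λ j s → 𝟙 (shatters s (child j B)) * weight s) ⟩
    ∑ᴾ n (λ s → ∑[ j < m ] (𝟙 (shatters s (child j B)) * weight s))
      ≡⟨ ∑ᴾ-cong n (λ s → sym (*-distribʳ-sum (weight s) (λ j → 𝟙 (shatters s (child j B))))) ⟩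
    ∑ᴾ n (λ s → branching s B * weight s)
      ≤⟨ ∑ᴾ-mono-≤ n (λ s → *-≤-thresholds (branching s B) (weight s) (∑-𝟙≤ _)) ⟩
    ∑ᴾ n (λ s → 𝟙 (shatters (false ∷ s) B) * (ω false * weight s)
               + 𝟙 (shatters (true ∷ s) B) * (ω true * weight s))
      ≡⟨ ∑ᴾ-distrib-+ n _ _ ⟩
    shatterWeight (suc n) B ∎
    where open ≤-Reasoning

  data Shattered : List Bool → List (List (Fin m)) → Set where
    leaf : ∀ {b B} → b ∈ B → Shattered [] B
    skip : ∀ {s B} j → Shattered s (child j B) → Shattered (false ∷ s) B
    branch : ∀ {s B} (g : Fin ℓ → Fin m) → Injective _≡_ _≡_ g →
             (∀ i → Shattered s (child (g i) B)) → Shattered (true ∷ s) B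

  shatters⇒Shattered : ∀ s B → T (shatters s B) → Shattered s B
  shatters⇒Shattered [] (b ∷ B) _ = leaf (here refl)
  shatters⇒Shattered (false ∷ s) B t
    with g , _ , pg ← distinct-choice (λ j → shatters s (child j B)) (≤ᵇ⇒≤ 1 _ t) =
    skip (g zero) (shatters⇒Shattered s _ (pg zero))
  shatters⇒Shattered (true ∷ s) B t
    with g , g-inj , pg ← distinct-choice (λ j → shatters s (child j B)) (≤ᵇ⇒≤ ℓ _ t) =
    branch g g-inj (λ i → shatters⇒Shattered s _ (pg i))

  embed : ∀ {s B} → Shattered s B → List (Fin ℓ) → List (Fin m)
  embed (leaf _) a = []
  embed (skip j w) a = j ∷ embed w a
  embed (branch g _ ws) [] = []
  embed (branch g _ ws) (i ∷ a) = g i ∷ embed (ws i) a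

  embed-InCheck : Fin ℓ → ∀ {s B} (w : Shattered s B) a → InCheck B (embed w a)
  embed-InCheck i₀ (leaf b∈) a = _ , b∈ , (_ , refl)
  embed-InCheck i₀ {B = B} (skip j w) a = InCheck-child j B (embed-InCheck i₀ w a)
  embed-InCheck i₀ {B = B} (branch g _ ws) [] =
    InCheck-[] B (InCheck-child (g i₀) B (embed-InCheck i₀ (ws i₀) []))
  embed-InCheck i₀ {B = B} (branch g _ ws) (i ∷ a) =
    InCheck-child (g i) B (embed-InCheck i₀ (ws i) a)

  embed-injective : ∀ {s B} (w : Shattered s B) {a a′} →
    length a ≤ height s → length a′ ≤ height s → embed w a ≡ embed w a′ → a ≡ a′
  embed-injective (leaf _) {[]} {[]} _ _ _ = refl
  embed-injective (skip j w) a≤ a′≤ eq = embed-injective w a≤ a′≤ (∷-injectiveʳ eq)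
  embed-injective (branch g g-inj ws) {[]} {[]} _ _ _ = refl
  embed-injective (branch g g-inj ws) {i ∷ a} {i′ ∷ a′} (s≤s a≤) (s≤s a′≤) eq
    with refl ← g-inj (∷-injectiveˡ eq) =
    cong (i ∷_) (embed-injective (ws i) a≤ a′≤ (∷-injectiveʳ eq))

  length-embed : ∀ {s B} (w : Shattered s B) a → length (embed w a) ≡ levelDepth s (length a)
  length-embed (leaf _) a = refl
  length-embed (skip j w) a = cong suc (length-embed w a)
  length-embed (branch g _ ws) [] = refl
  length-embed (branch g _ ws) (i ∷ a) = cong suc (length-embed (ws i) a)

  embed-meet : ∀ {s B} (w : Shattered s B) a a′ →
    embed w (meet a a′) ≡ meet (embed w a) (embed w a′)
  embed-meet (leaf _) a a′ = refl
  embed-meet (skip j w) a a′ = trans (cong (j ∷_) (embed-meet w a a′)) (sym (meet-∷-≡ j _ _))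
  embed-meet (branch g g-inj ws) [] a′ = refl
  embed-meet (branch g g-inj ws) (i ∷ a) [] = refl
  embed-meet (branch g g-inj ws) (i ∷ a) (i′ ∷ a′) with i ≟ i′
  ... | yes refl = trans (cong (g i ∷_) (embed-meet (ws i) a a′)) (sym (meet-∷-≡ (g i) _ _))
  ... | no i≢i′ = sym (meet-∷-≢ _ _ (i≢i′ ∘ g-inj))

  embed-≺ : ∀ {s B} (w : Shattered s B) {a a′} →
    length a ≤ height s → length a′ ≤ height s → a ≺ a′ ⇔ embed w a ≺ embed w a′
  embed-≺ (leaf _) {[]} {[]} _ _ = ¬⇔¬ ≺-irrefl-[] ≺-irrefl-[]
  embed-≺ (skip j w) a≤ a′≤ = ≺⇔∷≺∷ j ⇔-∘ embed-≺ w a≤ a′≤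
  embed-≺ (branch g g-inj ws) {[]} {[]} _ _ = ¬⇔¬ ≺-irrefl-[] ≺-irrefl-[]
  embed-≺ (branch g g-inj ws) {[]} {_ ∷ _} _ _ = mk⇔ (λ _ → []≺∷) (λ _ → []≺∷)
  embed-≺ (branch g g-inj ws) {_ ∷ _} {[]} _ _ = ¬⇔¬ ∷-⊀-[] ∷-⊀-[]
  embed-≺ (branch g g-inj ws) {i ∷ a} {i′ ∷ a′} (s≤s a≤) (s≤s a′≤) = mk⇔ to from
    where
    to : (i ∷ a) ≺ (i′ ∷ a′) → (g i ∷ embed (ws i) a) ≺ (g i′ ∷ embed (ws i′) a′)
    to i∷a≺ with refl , a≺a′ ← ∷-≺-∷ i∷a≺ = ≺-∷ (g i) (Equivalence.to (embed-≺ (ws i) a≤ a′≤) a≺a′)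
    from : (g i ∷ embed (ws i) a) ≺ (g i′ ∷ embed (ws i′) a′) → (i ∷ a) ≺ (i′ ∷ a′)
    from gi∷≺ with gi≡gi′ , e≺e′ ← ∷-≺-∷ gi∷≺ with refl ← g-inj gi≡gi′ =
      ≺-∷ i (Equivalence.from (embed-≺ (ws i) a≤ a′≤) e≺e′)

  embed-∼ : ∀ {s B} (w : Shattered s B) a a′ →
    length a ≤ height s → length a′ ≤ height s → a ∼ a′ ⇔ embed w a ∼ embed w a′
  embed-∼ {s} w a a′ a≤ a′≤ = mk⇔
    (λ eq → trans (length-embed w a) (trans (cong (levelDepth s) eq) (sym (length-embed w a′))))
    (λ eq → levelDepth-injective s a≤ a′≤
              (trans (sym (length-embed w a)) (trans eq (length-embed w a′))))

  Shattered⇒TreeEmbeds : Fin ℓ → ∀ {s B} → Shattered s B → TreeEmbeds (height s) ℓ B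
  Shattered⇒TreeEmbeds i₀ w =
    embed w ,
    (λ a _ → embed-InCheck i₀ w a) ,
    (λ _ _ a≤ a′≤ → embed-injective w a≤ a′≤) ,
    (λ _ _ → embed-≺ w) ,
    (λ a a′ _ _ → embed-meet w a a′) ,
    embed-∼ w

  shatters⇒height≤ : Fin ℓ → ∀ {B d} → LTD≤ ℓ B d →
    ∀ s → T (shatters s B) → T (ℤ.+ height s ℤ.≤ᵇ d)
  shatters⇒height≤ i₀ {B} (_ , embeddable⇒≤) s B-shatters =
    ℤ.≤⇒≤ᵇ (embeddable⇒≤ B≢[] (height s) (Shattered⇒TreeEmbeds i₀ w))
    where
    w = shatters⇒Shattered s B B-shatters
    B≢[] : B ≢ []
    B≢[] with b , b∈B , _ ← embed-InCheck i₀ w [] = ∈⇒≢[] b∈B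

theorem2p2 : (m ℓ n : ℕ) (d : ℤ) → 2 ≤ ℓ → ℓ ≤ m →
    (B : List (List (Fin m))) → IsLeafSet m n B → LTD≤ ℓ B d →
    length B ≤ bound m ℓ n d
theorem2p2 m ℓ n d 2≤ℓ _ B (lengths , unique) ltd = begin
  length B                                          ≤⟨ length≤shatterWeight n lengths unique ⟩
  ∑ᴾ n (λ s → 𝟙 (shatters s B) * weight s)          ≤⟨ ∑ᴾ-mono-≤ n shattered⇒height≤d ⟩
  ∑ᴾ n (λ s → 𝟙 (ℤ.+ height s ℤ.≤ᵇ d) * weight s)  ≡⟨ sumTo-binomial≡∑ᴾ-height≤ n d ⟨
  bound m ℓ n d                                     ∎
  where
  open Shattering m ℓ
  open ≤-Reasoning
  shattered⇒height≤d : ∀ s → 𝟙 (shatters s B) * weight s ≤ 𝟙 (ℤ.+ height s ℤ.≤ᵇ d) * weight s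
  shattered⇒height≤d s = *-monoˡ-≤ (weight s) (𝟙-mono (shatters⇒height≤ (fromℕ< 2≤ℓ) ltd s))
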